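{- Let $n\geqslant 3$ be odd and let $u$ be any vertex of the bubble-sort star graph $BS_n$. Then the vertices $u, R(u,1), R(u,2),\ldots,R(u,n-1)$ form a distance-$(n-1)$ independent set in $BS_n$.
   Context: For $n\geqslant 3$, the bubble-sort star graph $BS_n$ has as vertices the $n!$ permutations $(u_1u_2\ldots u_n)$ of $\{1,2,\ldots,n\}$. Let $\mathcal{T}=\{(1,2),(1,3),\ldots,(1,n),(2,3),(3,4),\ldots,(n-1,n)\}$. Two vertices are adjacent iff one is obtained from the other by swapping the entries in positions $i$ and $j$ for some $(i,j)\in\mathcal{T}$. $R(u,k)$ denotes the permutation obtained from $u=(u_1\ldots u_n)$ by $k$ consecutive rotations, i.e., $R(u,k)=(u_{k+1}u_{k+2}\ldots u_nu_1\ldots u_k)$. A distance-$k$ independent set in a graph is a set $S$ of vertices such that for every pair of distinct vertices $x,y\in S$, the distance (length of a shortest path) between $x$ and $y$ is at least $k$. -}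

module Defs where

open import Data.Nat using (ℕ; zero; suc; _≤_; _+_)
open import Data.Fin using (Fin; toℕ; _≟_)
open import Data.Vec using (Vec; []; _∷_; _∷ʳ_; lookup; tabulate)
open import Data.Product using (Σ; _×_; ∃-syntax)
open import Data.Sum using (_⊎_)
open import Relation.Nullary using (yes; no)
open import Relation.Binary.PropositionalEquality using (_≡_)

-- Vertices of BS_n: permutations of n symbols, written as the vector
-- (u_1 ... u_n) of their entries.  Symbols are Fin n = {0,...,n-1}
-- (a relabelling of {1,...,n}); positions are Fin n as well (0-indexed).
IsPerm : ∀ {n} → Vec (Fin n) n → Set
IsPerm {n} u = ∀ (i j : Fin n) → lookup u i ≡ lookup u j → i ≡ j

-- The set 𝒯 of position pairs, 0-indexed:
-- (1,j) for 2≤j≤n  becomes  (0, j') with j' ≥ 1;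
-- (i,i+1) for 2≤i≤n-1 becomes (i', i'+1) with i' ≥ 1.
InT : ∀ {n} → Fin n → Fin n → Set
InT i j = (toℕ i ≡ 0 × 1 ≤ toℕ j) ⊎ (1 ≤ toℕ i × toℕ j ≡ suc (toℕ i))

transpose : ∀ {n} → Fin n → Fin n → Fin n → Fin n
transpose i j k with k ≟ i
... | yes _ = j
... | no _ with k ≟ j
...   | yes _ = i
...   | no _ = k

swap : ∀ {n} {A : Set} → Fin n → Fin n → Vec A n → Vec A n
swap i j u = tabulate (λ k → lookup u (transpose i j k))

Adj : ∀ {n} → Vec (Fin n) n → Vec (Fin n) n → Set
Adj {n} u v = ∃[ i ] ∃[ j ] (InT {n} i j × v ≡ swap i j u)

-- walks of a given length (swaps preserve being a permutation, so walks
-- from a permutation stay inside BS_n)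
data Walk {n} : Vec (Fin n) n → Vec (Fin n) n → ℕ → Set where
  here : ∀ {u} → Walk u u 0
  step : ∀ {u v w ℓ} → Adj u v → Walk v w ℓ → Walk u w (suc ℓ)

-- dist(x,y) ≥ k : every walk (in particular every shortest path) has length ≥ k
DistAtLeast : ∀ {n} → ℕ → Vec (Fin n) n → Vec (Fin n) n → Set
DistAtLeast k x y = ∀ ℓ → Walk x y ℓ → k ≤ ℓ

rot1 : ∀ {A : Set} {n} → Vec A n → Vec A n
rot1 [] = []
rot1 (x ∷ xs) = xs ∷ʳ x

R : ∀ {A : Set} {n} → Vec A n → ℕ → Vec A n
R u zero = u
R u (suc k) = rot1 (R u k)

-- A walk in BS_n performs a permutation σ of positions, the product of the
-- transpositions along it, and between the rotations R(u,i) and R(u,j) this σ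
-- is the translation p ↦ p + j − i (mod n).  A nonzero translation leaves no
-- interval [lo, hi] with 1 ≤ lo invariant: it would have to fix the lower end.
-- Hence for every c < n − 1 some step swaps either positions c+1, c+2, or
-- position 0 with a position of the maximal run of adjacent swaps ending at
-- c+1 (otherwise that run would be invariant).  Distinct c give distinct steps,
-- so the walk has length at least n − 1.
module Submission where

open import Defs
open import Data.Empty using (⊥-elim)
open import Data.Fin using (Fin; zero; suc; toℕ; fromℕ; fromℕ<; inject₁; lower₁)
  renaming (_≟_ to _≟ᶠ_)
open import Data.Fin.Properties
  using (toℕ-injective; toℕ<n; toℕ-fromℕ; toℕ-fromℕ<; toℕ-lower₁; inject₁-lower₁; any?; injective⇒≤)
open import Data.Nat using (ℕ; zero; suc; _+_; _∸_; _≤_; _<_; _%_; s≤s; z≤n; s≤s⁻¹; NonZero; _≟_; _≤?_)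
open import Data.Nat.DivMod using (_mod_; %-distribˡ-+; %-remove-+ˡ; m%n%n≡m%n; m<n⇒m%n≡m; n%n≡0)
open import Data.Nat.Divisibility using (∣-refl)
open import Data.Nat.Properties
  using (suc-injective; +-assoc; +-comm; +-suc; m∸n+n≡m; ≤-refl; ≤-trans; ≤-antisym; <-trans;
         ≤-<-trans; <-≤-trans; <-irrefl; <-cmp; <⇒≤; <⇒≱; ≤⇒≯; ≰⇒>; ≤∧≢⇒<; n<1+n; n≮n;
         m<n⇒n≢0; m≤n⇒m≤1+n; m≤n⇒m<n∨m≡n; m<1+n⇒m<n∨m≡n)
open import Data.Product using (_×_; _,_; proj₁; proj₂; ∃)
open import Data.Sum using (inj₁; inj₂)
open import Data.Vec using (Vec; []; _∷_; _∷ʳ_; lookup)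
open import Data.Vec.Properties using (lookup∘tabulate)
open import Function using (_∘_; _⇔_; mk⇔; Equivalence; Injective)
import Function.Properties.Equivalence as ⇔
open import Relation.Binary using (tri<; tri≈; tri>)
open import Relation.Binary.PropositionalEquality
open import Relation.Nullary using (¬_; yes; no; contradiction)
open import Relation.Nullary.Decidable using (_×-dec_)
open import Relation.Unary using (Decidable)

open Equivalence using (to; from)

private variable
  A : Set
  m n ℓ : ℕ

module _ {N : ℕ} .{{_ : NonZero N}} where

  %-cong-+ˡ : ∀ k {a b} → a % N ≡ b % N → (k + a) % N ≡ (k + b) % N
  %-cong-+ˡ k {a} {b} eq = begin
    (k + a) % N             ≡⟨ %-distribˡ-+ k a N ⟩
    (k % N + a % N) % N     ≡⟨ cong (λ r → (k % N + r) % N) eq ⟩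
    (k % N + b % N) % N     ≡⟨ %-distribˡ-+ k b N ⟨
    (k + b) % N             ∎
    where open ≡-Reasoning

  %-cancel-+ˡ : ∀ {k a b} → k ≤ N → (k + a) % N ≡ (k + b) % N → a % N ≡ b % N
  %-cancel-+ˡ {k} {a} {b} k≤N eq = begin
    a % N                     ≡⟨ %-remove-+ˡ a ∣-refl ⟨
    (N + a) % N               ≡⟨ cong (_% N) (complete a) ⟩
    (N ∸ k + (k + a)) % N     ≡⟨ %-cong-+ˡ (N ∸ k) eq ⟩
    (N ∸ k + (k + b)) % N     ≡⟨ cong (_% N) (complete b) ⟨
    (N + b) % N               ≡⟨ %-remove-+ˡ b ∣-refl ⟩
    b % N                     ∎
    where
    open ≡-Reasoning
    complete : ∀ c → N + c ≡ N ∸ k + (k + c)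
    complete c = trans (cong (_+ c) (sym (m∸n+n≡m k≤N))) (+-assoc (N ∸ k) k c)

  %-injective : ∀ {a b} → a < N → b < N → a % N ≡ b % N → a ≡ b
  %-injective a<N b<N eq = trans (sym (m<n⇒m%n≡m a<N)) (trans eq (m<n⇒m%n≡m b<N))

lookup-∷ʳ-fromℕ : ∀ (xs : Vec A m) x → lookup (xs ∷ʳ x) (fromℕ m) ≡ x
lookup-∷ʳ-fromℕ []       x = refl
lookup-∷ʳ-fromℕ (_ ∷ xs) x = lookup-∷ʳ-fromℕ xs x

lookup-∷ʳ-inject₁ : ∀ (xs : Vec A m) x i → lookup (xs ∷ʳ x) (inject₁ i) ≡ lookup xs i
lookup-∷ʳ-inject₁ (_ ∷ xs) x zero    = refl
lookup-∷ʳ-inject₁ (_ ∷ xs) x (suc i) = lookup-∷ʳ-inject₁ xs x i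

lookup-rot1 : ∀ (v : Vec A (suc m)) p → lookup (rot1 v) p ≡ lookup v (suc (toℕ p) mod suc m)
lookup-rot1 {m = m} (x ∷ xs) p with toℕ p ≟ m
... | yes p≡m = begin
  lookup (xs ∷ʳ x) p          ≡⟨ cong (lookup (xs ∷ʳ x)) (toℕ-injective (trans p≡m (sym (toℕ-fromℕ m)))) ⟩
  lookup (xs ∷ʳ x) (fromℕ m)  ≡⟨ lookup-∷ʳ-fromℕ xs x ⟩
  x                           ≡⟨ cong (lookup (x ∷ xs)) (toℕ-injective wraps) ⟨
  lookup (x ∷ xs) (suc (toℕ p) mod suc m) ∎
  where
  open ≡-Reasoning
  wraps : toℕ (suc (toℕ p) mod suc m) ≡ 0
  wraps = trans (toℕ-fromℕ< _) (trans (cong (λ a → suc a % suc m) p≡m) (n%n≡0 (suc m)))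
... | no p≢m = begin
  lookup (xs ∷ʳ x) p          ≡⟨ cong (lookup (xs ∷ʳ x)) (inject₁-lower₁ p (p≢m ∘ sym)) ⟨
  lookup (xs ∷ʳ x) (inject₁ q) ≡⟨ lookup-∷ʳ-inject₁ xs x q ⟩
  lookup (x ∷ xs) (suc q)     ≡⟨ cong (lookup (x ∷ xs)) (toℕ-injective no-wrap) ⟩
  lookup (x ∷ xs) (suc (toℕ p) mod suc m) ∎
  where
  open ≡-Reasoning
  q = lower₁ p (p≢m ∘ sym)
  no-wrap : suc (toℕ q) ≡ toℕ (suc (toℕ p) mod suc m)
  no-wrap = begin
    suc (toℕ q)          ≡⟨ cong suc (toℕ-lower₁ p (p≢m ∘ sym)) ⟩
    suc (toℕ p)          ≡⟨ m<n⇒m%n≡m (s≤s (≤∧≢⇒< (s≤s⁻¹ (toℕ<n p)) p≢m)) ⟨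
    suc (toℕ p) % suc m  ≡⟨ toℕ-fromℕ< _ ⟨
    toℕ (suc (toℕ p) mod suc m) ∎

lookup-R : ∀ (u : Vec A (suc m)) k p → lookup (R u k) p ≡ lookup u ((k + toℕ p) mod suc m)
lookup-R u zero p =
  cong (lookup u) (toℕ-injective (sym (trans (toℕ-fromℕ< _) (m<n⇒m%n≡m (toℕ<n p)))))
lookup-R {m = m} u (suc k) p = begin
  lookup (rot1 (R u k)) p                 ≡⟨ lookup-rot1 (R u k) p ⟩
  lookup (R u k) q                        ≡⟨ lookup-R u k q ⟩
  lookup u ((k + toℕ q) mod suc m)        ≡⟨ cong (lookup u) (toℕ-injective index) ⟩
  lookup u ((suc k + toℕ p) mod suc m)    ∎
  where
  open ≡-Reasoning
  q = suc (toℕ p) mod suc m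
  index : toℕ ((k + toℕ q) mod suc m) ≡ toℕ ((suc k + toℕ p) mod suc m)
  index = begin
    toℕ ((k + toℕ q) mod suc m)             ≡⟨ toℕ-fromℕ< _ ⟩
    (k + toℕ q) % suc m                     ≡⟨ cong (λ r → (k + r) % suc m) (toℕ-fromℕ< _) ⟩
    (k + suc (toℕ p) % suc m) % suc m       ≡⟨ %-cong-+ˡ k (m%n%n≡m%n (suc (toℕ p)) (suc m)) ⟩
    (k + suc (toℕ p)) % suc m               ≡⟨ cong (_% suc m) (+-suc k (toℕ p)) ⟩
    (suc k + toℕ p) % suc m                 ≡⟨ toℕ-fromℕ< _ ⟨
    toℕ ((suc k + toℕ p) mod suc m)         ∎

_∈[_,_] : ℕ → ℕ → ℕ → Set
x ∈[ lo , hi ] = lo ≤ x × x ≤ hi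

Invariant : (Fin n → Fin n) → (Fin n → Set) → Set
Invariant σ P = ∀ p → P p ⇔ P (σ p)

module _ {N : ℕ} .{{_ : NonZero N}} where

  -- σ adds j − i modulo N (stated without subtraction)
  Shifts : ℕ → ℕ → (Fin N → Fin N) → Set
  Shifts i j σ = ∀ p → (j + toℕ p) % N ≡ (i + toℕ (σ p)) % N

  -- σ maps the lower end lo of the interval to an element whose predecessor
  -- lies outside, i.e. to lo itself; so the shift j − i is zero.
  shift-invariant-interval⇒≡ : ∀ {i j lo hi} {σ : Fin N → Fin N} →
    i < N → j < N → 1 ≤ lo → lo ≤ hi → hi < N →
    Shifts i j σ → Invariant σ (λ p → toℕ p ∈[ lo , hi ]) → i ≡ j
  shift-invariant-interval⇒≡ {i} {j} {suc s} {hi} {σ} i<N j<N (s≤s z≤n) lo≤hi hi<N shifts inv =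
    sym (%-injective j<N i<N (%-cancel-+ˡ (<⇒≤ lo<N) (begin
      (suc s + j) % N   ≡⟨ cong (_% N) (+-comm (suc s) j) ⟩
      (j + suc s) % N   ≡⟨ shift-at lo<N ⟩
      (i + q₁) % N      ≡⟨ cong (λ q → (i + q) % N) q₁≡lo ⟩
      (i + suc s) % N   ≡⟨ cong (_% N) (+-comm i (suc s)) ⟩
      (suc s + i) % N   ∎)))
    where
    open ≡-Reasoning
    lo<N : suc s < N
    lo<N = ≤-<-trans lo≤hi hi<N
    s<N : s < N
    s<N = <-trans (n<1+n s) lo<N
    shift-at : ∀ {a} (a<N : a < N) → (j + a) % N ≡ (i + toℕ (σ (fromℕ< a<N))) % N
    shift-at a<N = trans (cong (λ a → (j + a) % N) (sym (toℕ-fromℕ< a<N))) (shifts _)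
    q₁ q₀ : ℕ
    q₁ = toℕ (σ (fromℕ< lo<N))
    q₀ = toℕ (σ (fromℕ< s<N))
    q₁∈ : q₁ ∈[ suc s , hi ]
    q₁∈ = to (inv _) (subst (_∈[ suc s , hi ]) (sym (toℕ-fromℕ< lo<N)) (≤-refl , lo≤hi))
    q₀∉ : ¬ q₀ ∈[ suc s , hi ]
    q₀∉ q₀∈ = n≮n s (proj₁ (subst (_∈[ suc s , hi ]) (toℕ-fromℕ< s<N) (from (inv _) q₀∈)))
    q₁≡1+q₀-mod : q₁ % N ≡ suc q₀ % N
    q₁≡1+q₀-mod = %-cancel-+ˡ (<⇒≤ i<N) (begin
      (i + q₁) % N      ≡⟨ shift-at lo<N ⟨
      (j + suc s) % N   ≡⟨ cong (_% N) (+-suc j s) ⟩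
      suc (j + s) % N   ≡⟨ %-cong-+ˡ 1 (shift-at s<N) ⟩
      suc (i + q₀) % N  ≡⟨ cong (_% N) (+-suc i q₀) ⟨
      (i + suc q₀) % N  ∎)
    q₁≡1+q₀ : q₁ ≡ suc q₀
    q₁≡1+q₀ with m≤n⇒m<n∨m≡n (toℕ<n (σ (fromℕ< s<N)))
    ... | inj₁ 1+q₀<N = %-injective (toℕ<n _) 1+q₀<N q₁≡1+q₀-mod
    ... | inj₂ 1+q₀≡N = contradiction q₁≡0 (m<n⇒n≢0 (proj₁ q₁∈))
      where
      q₁≡0 : q₁ ≡ 0
      q₁≡0 = trans (sym (m<n⇒m%n≡m (toℕ<n _)))
                   (trans q₁≡1+q₀-mod (trans (cong (_% N) 1+q₀≡N) (n%n≡0 N)))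
    q₁≡lo : q₁ ≡ suc s
    q₁≡lo = ≤-antisym (subst (_≤ suc s) (sym q₁≡1+q₀) q₀<lo) (proj₁ q₁∈)
      where
      q₀<lo : q₀ < suc s
      q₀<lo = ≰⇒> (λ lo≤q₀ → q₀∉ (lo≤q₀ , <⇒≤ (subst (_≤ hi) q₁≡1+q₀ (proj₂ q₁∈))))

R-shifts : ∀ (u : Vec A (suc m)) {i j} {σ : Fin (suc m) → Fin (suc m)} →
  Injective _≡_ _≡_ (lookup u) → (∀ p → lookup (R u j) p ≡ lookup (R u i) (σ p)) →
  Shifts i j σ
R-shifts {m = m} u {i} {j} {σ} u-injective moves p = begin
  (j + toℕ p) % suc m              ≡⟨ toℕ-fromℕ< _ ⟨
  toℕ ((j + toℕ p) mod suc m)      ≡⟨ cong toℕ (u-injective same-entry) ⟩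
  toℕ ((i + toℕ (σ p)) mod suc m)  ≡⟨ toℕ-fromℕ< _ ⟩
  (i + toℕ (σ p)) % suc m          ∎
  where
  open ≡-Reasoning
  same-entry : lookup u ((j + toℕ p) mod suc m) ≡ lookup u ((i + toℕ (σ p)) mod suc m)
  same-entry = trans (sym (lookup-R u j p)) (trans (moves p) (lookup-R u i (σ p)))

swapAt : {x y : Vec (Fin n) n} → Walk x y ℓ → Fin ℓ → Fin n × Fin n
swapAt (step (a , b , _) _) zero    = a , b
swapAt (step _ w)           (suc t) = swapAt w t

swapAt-InT : {x y : Vec (Fin n) n} (w : Walk x y ℓ) (t : Fin ℓ) → InT (proj₁ (swapAt w t)) (proj₂ (swapAt w t))
swapAt-InT (step (_ , _ , a-b∈T , _) _) zero    = a-b∈T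
swapAt-InT (step _ w)                   (suc t) = swapAt-InT w t

trace : {x y : Vec (Fin n) n} → Walk x y ℓ → Fin n → Fin n
trace here                     = λ p → p
trace (step (a , b , _ , _) w) = transpose a b ∘ trace w

lookup-trace : {x y : Vec (Fin n) n} (w : Walk x y ℓ) → ∀ p → lookup y p ≡ lookup x (trace w p)
lookup-trace here                         p = refl
lookup-trace (step {u = u} (a , b , _ , refl) w) p =
  trans (lookup-trace w p) (lookup∘tabulate (lookup u ∘ transpose a b) (trace w p))

transpose-invariant : ∀ (P : Fin n → Set) {a b} → P a ⇔ P b → Invariant (transpose a b) P
transpose-invariant P {a} {b} Pa⇔Pb k with k ≟ᶠ a
... | yes refl = Pa⇔Pb
... | no _ with k ≟ᶠ b
...   | yes refl = ⇔.sym Pa⇔Pb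
...   | no _     = ⇔.refl

trace-invariant : ∀ (P : Fin n → Set) {x y : Vec (Fin n) n} (w : Walk x y ℓ) →
  (∀ t → P (proj₁ (swapAt w t)) ⇔ P (proj₂ (swapAt w t))) → Invariant (trace w) P
trace-invariant P here                 _     p = ⇔.refl
trace-invariant P (step (a , b , _) w) swaps p =
  ⇔.trans (trace-invariant P w (swaps ∘ suc) p) (transpose-invariant P (swaps zero) (trace w p))

-- [runStart c, suc c] is the longest interval of positive numbers ending at
-- suc c such that P holds at each of its points except the last.
module Run {P : ℕ → Set} (P? : Decidable P) where

  runStart : ℕ → ℕ
  runStart zero = 1
  runStart (suc c) with P? (suc c)
  ... | yes _ = runStart c
  ... | no _  = suc (suc c)

  InRun : ℕ → ℕ → Set
  InRun c x = x ∈[ runStart c , suc c ]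

  1≤runStart : ∀ c → 1 ≤ runStart c
  1≤runStart zero = ≤-refl
  1≤runStart (suc c) with P? (suc c)
  ... | yes _ = 1≤runStart c
  ... | no _  = s≤s z≤n

  runStart≤ : ∀ c → runStart c ≤ suc c
  runStart≤ zero = ≤-refl
  runStart≤ (suc c) with P? (suc c)
  ... | yes _ = m≤n⇒m≤1+n (runStart≤ c)
  ... | no _  = ≤-refl

  run-holds : ∀ c {x} → runStart c ≤ x → x < suc c → P x
  run-holds zero    1≤x x<1 = contradiction (<-≤-trans x<1 1≤x) (<-irrefl refl)
  run-holds (suc c) {x} start≤x x<2+c with P? (suc c)
  ... | no _  = contradiction x<2+c (≤⇒≯ start≤x)
  ... | yes p with m<1+n⇒m<n∨m≡n x<2+c
  ...   | inj₁ x<1+c = run-holds c start≤x x<1+c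
  ...   | inj₂ refl  = p

  run-maximal : ∀ c {a} → 1 ≤ a → P a → runStart c ≢ suc a
  run-maximal zero    1≤a _ refl = contradiction 1≤a (<-irrefl refl)
  run-maximal (suc c) 1≤a Pa with P? (suc c)
  ... | yes _ = run-maximal c 1≤a Pa
  ... | no ¬P = λ 2+c≡1+a → ¬P (subst P (sym (suc-injective 2+c≡1+a)) Pa)

  InRun-suc : ∀ c {a} → ¬ P (suc c) → 1 ≤ a → P a → InRun c a ⇔ InRun c (suc a)
  InRun-suc c {a} ¬P[1+c] 1≤a Pa = mk⇔ forward backward
    where
    forward : InRun c a → InRun c (suc a)
    forward (start≤a , a≤1+c) =
      m≤n⇒m≤1+n start≤a , ≤∧≢⇒< a≤1+c (λ a≡1+c → ¬P[1+c] (subst P a≡1+c Pa))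
    backward : InRun c (suc a) → InRun c a
    backward (start≤1+a , 1+a≤1+c) with m≤n⇒m<n∨m≡n start≤1+a
    ... | inj₁ start<1+a = s≤s⁻¹ start<1+a , <⇒≤ 1+a≤1+c
    ... | inj₂ start≡1+a = contradiction start≡1+a (run-maximal c 1≤a Pa)

  InRun-unique : ∀ {c₁ c₂ x} → ¬ P (suc c₁) → ¬ P (suc c₂) → InRun c₁ x → InRun c₂ x → c₁ ≡ c₂
  InRun-unique {c₁} {c₂} ¬P₁ ¬P₂ (start₁≤x , x≤1+c₁) (start₂≤x , x≤1+c₂) with <-cmp c₁ c₂
  ... | tri≈ _ c₁≡c₂ _ = c₁≡c₂
  ... | tri< c₁<c₂ _ _ = contradiction (run-holds c₂ (≤-trans start₂≤x x≤1+c₁) (s≤s c₁<c₂)) ¬P₁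
  ... | tri> _ _ c₂<c₁ = contradiction (run-holds c₁ (≤-trans start₁≤x x≤1+c₂) (s≤s c₂<c₁)) ¬P₂

NoInvariantInterval : (Fin n → Fin n) → Set
NoInvariantInterval {n} σ =
  ∀ {lo hi} → 1 ≤ lo → lo ≤ hi → hi < n → ¬ Invariant σ (λ p → toℕ p ∈[ lo , hi ])

module Covering {x y : Vec (Fin (suc m)) (suc m)} (w : Walk x y ℓ) where

  Swaps : Fin ℓ → ℕ → ℕ → Set
  Swaps t a b = toℕ (proj₁ (swapAt w t)) ≡ a × toℕ (proj₂ (swapAt w t)) ≡ b

  SwapsAdjacent : ℕ → Set
  SwapsAdjacent a = ∃ λ t → Swaps t a (suc a)

  swapsAdjacent? : Decidable SwapsAdjacent
  swapsAdjacent? a = any? λ t → (toℕ (proj₁ (swapAt w t)) ≟ a) ×-dec (toℕ (proj₂ (swapAt w t)) ≟ suc a)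

  open Run swapsAdjacent?

  Hub : ℕ → Fin ℓ → Set
  Hub c t = toℕ (proj₁ (swapAt w t)) ≡ 0 × InRun c (toℕ (proj₂ (swapAt w t)))

  hub? : ∀ c → Decidable (Hub c)
  hub? c t = (toℕ (proj₁ (swapAt w t)) ≟ 0)
       ×-dec ((runStart c ≤? toℕ (proj₂ (swapAt w t))) ×-dec (toℕ (proj₂ (swapAt w t)) ≤? suc c))

  data Covers (c : ℕ) (t : Fin ℓ) : Set where
    adjacent : Swaps t (suc c) (suc (suc c)) → Covers c t
    hub      : ¬ SwapsAdjacent (suc c) → Hub c t → Covers c t

  covers-unique : ∀ {c₁ c₂ t} → Covers c₁ t → Covers c₂ t → c₁ ≡ c₂
  covers-unique (adjacent (a≡1+c₁ , _)) (adjacent (a≡1+c₂ , _)) = suc-injective (trans (sym a≡1+c₁) a≡1+c₂)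
  covers-unique (adjacent (a≡1+c₁ , _)) (hub _ (a≡0 , _))         = contradiction (trans (sym a≡1+c₁) a≡0) λ ()
  covers-unique (hub _ (a≡0 , _))         (adjacent (a≡1+c₂ , _)) = contradiction (trans (sym a≡0) a≡1+c₂) λ ()
  covers-unique (hub ¬P₁ (_ , b∈₁))       (hub ¬P₂ (_ , b∈₂))       = InRun-unique ¬P₁ ¬P₂ b∈₁ b∈₂

  run-invariant : ∀ c → ¬ SwapsAdjacent (suc c) → ¬ ∃ (Hub c) →
    ∀ t → InRun c (toℕ (proj₁ (swapAt w t))) ⇔ InRun c (toℕ (proj₂ (swapAt w t)))
  run-invariant c ¬P[1+c] ¬hub t with swapAt-InT w t
  ... | inj₁ (a≡0 , _) = mk⇔ (λ (start≤a , _) → contradiction (subst (runStart c ≤_) a≡0 start≤a) start≰0)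
                             (λ b∈run → ⊥-elim (¬hub (t , a≡0 , b∈run)))
    where
    start≰0 : ¬ runStart c ≤ 0
    start≰0 = <⇒≱ (1≤runStart c)
  ... | inj₂ (1≤a , b≡1+a) = subst (λ b → InRun c (toℕ (proj₁ (swapAt w t))) ⇔ InRun c b) (sym b≡1+a)
                                   (InRun-suc c ¬P[1+c] 1≤a (t , refl , b≡1+a))

  covered : NoInvariantInterval (trace w) → ∀ c → c < m → ∃ (Covers c)
  covered no-invariant c c<m with swapsAdjacent? (suc c)
  ... | yes (t , swaps) = t , adjacent swaps
  ... | no ¬P[1+c] with any? (hub? c)
  ...   | yes (t , is-hub) = t , hub ¬P[1+c] is-hub
  ...   | no ¬hub = ⊥-elim (no-invariant (1≤runStart c) (runStart≤ c) (s≤s c<m)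
                      (trace-invariant (InRun c ∘ toℕ) w (run-invariant c ¬P[1+c] ¬hub)))

noInvariantInterval⇒m≤ℓ : ∀ {x y : Vec (Fin (suc m)) (suc m)} (w : Walk x y ℓ) →
  NoInvariantInterval (trace w) → m ≤ ℓ
noInvariantInterval⇒m≤ℓ {m} {ℓ} w no-invariant = injective⇒≤ covering-injective
  where
  open Covering w
  cover : (c : Fin m) → ∃ (Covers (toℕ c))
  cover c = covered no-invariant (toℕ c) (toℕ<n c)
  covering-injective : Injective _≡_ _≡_ (proj₁ ∘ cover)
  covering-injective {c₁} {c₂} t₁≡t₂ = toℕ-injective
    (covers-unique (proj₂ (cover c₁)) (subst (Covers (toℕ c₂)) (sym t₁≡t₂) (proj₂ (cover c₂))))

corollary3p3 : (n : ℕ) → 3 ≤ n → n % 2 ≡ 1 →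
    (u : Vec (Fin n) n) → IsPerm u →
    ∀ (i j : ℕ) → i < n → j < n → ¬ (R u i ≡ R u j) →
    DistAtLeast (n ∸ 1) (R u i) (R u j)
corollary3p3 zero    ()
corollary3p3 (suc m) _ _ u u-perm i j i<n j<n Rᵢ≢Rⱼ ℓ w =
  noInvariantInterval⇒m≤ℓ w λ 1≤lo lo≤hi hi<n invariant →
    Rᵢ≢Rⱼ (cong (R u) (shift-invariant-interval⇒≡ i<n j<n 1≤lo lo≤hi hi<n
      (R-shifts u {i} {j} (u-perm _ _) (lookup-trace w)) invariant))
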